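{- Let $L$ be any of the fifteen logics of the modal cube, let $\iota$ and $\kappa$ be two different truth values among $\mathbf{F},\mathbf{f},\mathbf{f}_2,\mathbf{f}_3,\mathbf{t}_3,\mathbf{t}_2,\mathbf{t},\mathbf{T}$, let $\alpha,\beta$ be formulas, and let $\Delta$ be a set of formulas that is consistent in $L$. Then: (1) if $\Delta\vdash_L \iota(\alpha)$ then $\Delta\nvdash_L \kappa(\alpha)$; (2) if $\iota\in\{\mathbf{t}_2,\mathbf{f}_2\}$, $\Delta\vdash_L\iota(\alpha)$ and $\Delta\vdash_L\kappa(\beta)$, then $\kappa\in\{\mathbf{t}_2,\mathbf{f}_2\}$.
   Context: Formulas are given by $\alpha ::= p \mid \bot \mid \alpha\to\alpha \mid \Box\alpha$ with $p$ ranging over a countable set of propositional variables; $\neg\alpha$ abbreviates $\alpha\to\bot$, $\Diamond\alpha$ abbreviates $\neg\Box\neg\alpha$, and $\wedge,\vee$ are the usual classical abbreviations. The logic $\mathbf K$ is axiomatized by the axioms of classical propositional logic, the axiom (k) $\Box(\alpha\to\beta)\to(\Box\alpha\to\Box\beta)$, and the rules modus ponens and necessitation (from $\alpha$ infer $\Box\alpha$). Further axiom schemes: (D) $\Box\alpha\to\Diamond\alpha$, (T) $\Box\alpha\to\alpha$, (B) $\alpha\to\Box\Diamond\alpha$, (4) $\Box\alpha\to\Box\Box\alpha$, (5) $\Diamond\alpha\to\Box\Diamond\alpha$. The modal cube consists of the fifteen logics $\mathbf K,\mathbf{KB},\mathbf{K4},\mathbf{K5},\mathbf{K45},\mathbf{KD},\mathbf{KDB},\mathbf{KD4},\mathbf{KD5},\mathbf{KD45},\mathbf{KT},\mathbf{KTB},\mathbf{S4}=\mathbf{KT4},\mathbf{S5}=\mathbf{KTB45},\mathbf{KB5}=\mathbf{KB45}$,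 each obtained from $\mathbf K$ by adding the axiom schemes named by its letters. For such $L$, $\vdash_L\alpha$ means $\alpha$ is a theorem of $L$, and $\Gamma\vdash_L\alpha$ means $\vdash_L\alpha$ or $\vdash_L(\gamma_1\wedge\dots\wedge\gamma_k)\to\alpha$ for some $\gamma_1,\dots,\gamma_k\in\Gamma$. A set $\Delta$ is consistent in $L$ if there is no $\alpha$ with both $\Delta\vdash_L\alpha$ and $\Delta\vdash_L\neg\alpha$. The eight truth values $\mathbf{F},\mathbf{f},\mathbf{f}_2,\mathbf{f}_3,\mathbf{t}_3,\mathbf{t}_2,\mathbf{t},\mathbf{T}$ each determine a formula $\iota(\alpha)$ for every formula $\alpha$ (the "modal characterization"): $\mathbf F(\alpha)=\Diamond\neg\alpha\wedge\neg\alpha\wedge\Box\neg\alpha$, $\mathbf f(\alpha)=\Diamond\neg\alpha\wedge\neg\alpha\wedge\Diamond\alpha$, $\mathbf f_2(\alpha)=\Box\alpha\wedge\neg\alpha\wedge\Box\neg\alpha$, $\mathbf f_3(\alpha)=\Box\alpha\wedge\neg\alpha\wedge\Diamond\alpha$, $\mathbf t_3(\alpha)=\Diamond\neg\alpha\wedge\alpha\wedge\Box\neg\alpha$, $\mathbf t_2(\alpha)=\Box\alpha\wedge\alpha\wedge\Box\neg\alpha$, $\mathbf t(\alpha)=\Diamond\neg\alpha\wedge\alpha\wedge\Diamond\alpha$, $\mathbf T(\alpha)=\Box\alpha\wedge\alpha\wedge\Diamond\alpha$. -}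

module Defs where

open import Data.Nat using (ℕ)
open import Data.List using (List; []; _∷_)
open import Data.List.Relation.Unary.All using (All)
open import Data.Product using (Σ; _×_)
open import Data.Sum using (_⊎_)
open import Relation.Nullary using (¬_)
open import Relation.Binary.PropositionalEquality using (_≡_)

data Fm : Set where
  var  : ℕ → Fm
  ⊥'   : Fm
  _⇒_  : Fm → Fm → Fm
  □_   : Fm → Fm

infixr 5 _⇒_
infix 9 □_

~_ : Fm → Fm
~ a = a ⇒ ⊥'

◇_ : Fm → Fm
◇ a = ~ (□ (~ a))

infix 9 ~_ ◇_

_∧'_ : Fm → Fm → Fm
a ∧' b = ~ (a ⇒ ~ b)

_∨'_ : Fm → Fm → Fm
a ∨' b = ~ a ⇒ b

infixr 6 _∧'_
infixr 6 _∨'_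

data Logic : Set where
  K KB K4 K5 K45 KD KDB KD4 KD5 KD45 KT KTB S4 S5 KB5 : Logic

-- Which extra axiom schemes each logic contains (by the letters of its name;
-- S4 = KT4, S5 = KTB45, KB5 = KB45)
data HasD : Logic → Set where
  KD' : HasD KD
  KDB' : HasD KDB
  KD4' : HasD KD4
  KD5' : HasD KD5
  KD45' : HasD KD45

data HasT : Logic → Set where
  KT' : HasT KT
  KTB' : HasT KTB
  S4' : HasT S4
  S5' : HasT S5

data HasB : Logic → Set where
  KB' : HasB KB
  KDB' : HasB KDB
  KTB' : HasB KTB
  S5' : HasB S5
  KB5' : HasB KB5

data Has4 : Logic → Set where
  K4' : Has4 K4
  K45' : Has4 K45
  KD4' : Has4 KD4
  KD45' : Has4 KD45
  S4' : Has4 S4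
  S5' : Has4 S5
  KB5' : Has4 KB5

data Has5 : Logic → Set where
  K5' : Has5 K5
  K45' : Has5 K45
  KD5' : Has5 KD5
  KD45' : Has5 KD45
  S5' : Has5 S5
  KB5' : Has5 KB5

data ⊢[_]_ (L : Logic) : Fm → Set where
  ax1 : ∀ a b → ⊢[ L ] (a ⇒ b ⇒ a)
  ax2 : ∀ a b c → ⊢[ L ] ((a ⇒ b ⇒ c) ⇒ (a ⇒ b) ⇒ a ⇒ c)
  ax3 : ∀ a → ⊢[ L ] (~ ~ a ⇒ a)
  axk : ∀ a b → ⊢[ L ] (□ (a ⇒ b) ⇒ □ a ⇒ □ b)
  axD : HasD L → ∀ a → ⊢[ L ] (□ a ⇒ ◇ a)
  axT : HasT L → ∀ a → ⊢[ L ] (□ a ⇒ a)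
  axB : HasB L → ∀ a → ⊢[ L ] (a ⇒ □ ◇ a)
  ax4 : Has4 L → ∀ a → ⊢[ L ] (□ a ⇒ □ □ a)
  ax5 : Has5 L → ∀ a → ⊢[ L ] (◇ a ⇒ □ ◇ a)
  mp  : ∀ {a b} → ⊢[ L ] (a ⇒ b) → ⊢[ L ] a → ⊢[ L ] b
  nec : ∀ {a} → ⊢[ L ] a → ⊢[ L ] (□ a)

FmSet : Set₁
FmSet = Fm → Set

bigConj : Fm → List Fm → Fm
bigConj g [] = g
bigConj g (h ∷ hs) = g ∧' bigConj h hs

_⊢[_]_ : FmSet → Logic → Fm → Set
Γ ⊢[ L ] a = (⊢[ L ] a) ⊎
  Σ Fm (λ g → Σ (List Fm) (λ gs → Γ g × All Γ gs × ⊢[ L ] (bigConj g gs ⇒ a)))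

Consistent : Logic → FmSet → Set
Consistent L Δ = ¬ Σ Fm (λ a → (Δ ⊢[ L ] a) × (Δ ⊢[ L ] (~ a)))

data TV : Set where
  F f f₂ f₃ t₃ t₂ t T : TV

⟦_⟧ : TV → Fm → Fm
⟦ F  ⟧ a = ◇ (~ a) ∧' ~ a ∧' □ (~ a)
⟦ f  ⟧ a = ◇ (~ a) ∧' ~ a ∧' ◇ a
⟦ f₂ ⟧ a = □ a ∧' ~ a ∧' □ (~ a)
⟦ f₃ ⟧ a = □ a ∧' ~ a ∧' ◇ a
⟦ t₃ ⟧ a = ◇ (~ a) ∧' a ∧' □ (~ a)
⟦ t₂ ⟧ a = □ a ∧' a ∧' □ (~ a)
⟦ t  ⟧ a = ◇ (~ a) ∧' a ∧' ◇ a
⟦ T  ⟧ a = □ a ∧' a ∧' ◇ a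

Degenerate : TV → Set
Degenerate v = (v ≡ t₂) ⊎ (v ≡ f₂)

-- A truth value is a triple of independent choices: □α or ◇¬α, α or ¬α, and ◇α or □¬α, and
-- in each pair the two formulas contradict each other (◇¬α is ¬□¬¬α). Two distinct truth
-- values differ in one of the three choices, so deriving both from Δ makes Δ inconsistent.
-- The degenerate values t₂ and f₂ are exactly those choosing both □α and □¬α; this yields
-- □⊥ and hence □γ for every γ, which refutes the ◇-formula every other truth value contains.
module Submission where

open import Defs
open import Data.Bool using (Bool; true; false; if_then_else_; _≟_)
open import Data.Empty using (⊥; ⊥-elim)
open import Data.List using (List; []; _∷_)
open import Data.List.Membership.Propositional using (_∈_)
open import Data.List.Relation.Unary.Any using (here; there)
open import Data.Product using (Σ; _×_; _,_; uncurry)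
open import Data.Sum using (_⊎_; inj₁; inj₂)
open import Function using (_∘_)
open import Relation.Binary.PropositionalEquality
  using (_≡_; _≢_; refl; sym; cong₂; subst₂; module ≡-Reasoning)
open import Relation.Nullary using (¬_; yes; no; contradiction)

module _ {L : Logic} where

  data _⊩_ (Γ : List Fm) : Fm → Set where
    thm : ∀ {a} → ⊢[ L ] a → Γ ⊩ a
    hyp : ∀ {a} → a ∈ Γ → Γ ⊩ a
    app : ∀ {a b} → Γ ⊩ (a ⇒ b) → Γ ⊩ a → Γ ⊩ b

  infix 3 _⊩_

  hyp₀ : ∀ {a Γ} → a ∷ Γ ⊩ a
  hyp₀ = hyp (here refl)

  hyp₁ : ∀ {a b Γ} → b ∷ a ∷ Γ ⊩ a
  hyp₁ = hyp (there (here refl))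

  ⇒-refl : ∀ a → ⊢[ L ] (a ⇒ a)
  ⇒-refl a = mp (mp (ax2 a (a ⇒ a) a) (ax1 a (a ⇒ a))) (ax1 a a)

  deduction : ∀ {Γ a b} → a ∷ Γ ⊩ b → Γ ⊩ a ⇒ b
  deduction {a = a} {b} (thm p)             = thm (mp (ax1 b a) p)
  deduction {a = a}     (hyp (here refl))   = thm (⇒-refl a)
  deduction {a = a} {b} (hyp (there b∈Γ))   = app (thm (ax1 b a)) (hyp b∈Γ)
  deduction {a = a} {b} (app {c} p q)       =
    app (app (thm (ax2 a c b)) (deduction p)) (deduction q)

  ⊩-closed : ∀ {a} → [] ⊩ a → ⊢[ L ] a
  ⊩-closed (thm p)   = p
  ⊩-closed (hyp ())
  ⊩-closed (app p q) = mp (⊩-closed p) (⊩-closed q)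

  ⇒-trans : ∀ {a b c} → ⊢[ L ] (a ⇒ b) → ⊢[ L ] (b ⇒ c) → ⊢[ L ] (a ⇒ c)
  ⇒-trans p q = ⊩-closed (deduction (app (thm q) (app (thm p) hyp₀)))

  ex-falso : ∀ a → ⊢[ L ] (⊥' ⇒ a)
  ex-falso a = ⊩-closed (deduction (app (thm (ax3 a)) (deduction hyp₁)))

  ~~-intro : ∀ a → ⊢[ L ] (a ⇒ ~ ~ a)
  ~~-intro a = ⊩-closed (deduction (deduction (app hyp₀ hyp₁)))

  ∧-elimˡ : ∀ {a b} → ⊢[ L ] (a ∧' b ⇒ a)
  ∧-elimˡ {a} {b} = ⊩-closed (deduction (app (thm (ax3 a))
    (deduction (app hyp₁ (deduction (app (thm (ex-falso (~ b))) (app hyp₁ hyp₀)))))))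

  ∧-elimʳ : ∀ {a b} → ⊢[ L ] (a ∧' b ⇒ b)
  ∧-elimʳ {a} {b} = ⊩-closed (deduction (app (thm (ax3 b)) (deduction (app hyp₁ (deduction hyp₁)))))

  □-mono : ∀ {a b} → ⊢[ L ] (a ⇒ b) → ⊢[ L ] (□ a ⇒ □ b)
  □-mono {a} {b} p = mp (axk a b) (nec p)

  □-and-□~⇒□⊥ : ∀ {a b} → ⊢[ L ] (□ a ∧' b ∧' □ (~ a) ⇒ □ ⊥')
  □-and-□~⇒□⊥ {a} = ⊩-closed (deduction (app
    (app (thm (axk a ⊥')) (app (thm (⇒-trans ∧-elimʳ ∧-elimʳ)) hyp₀))
    (app (thm ∧-elimˡ) hyp₀)))

  ⊢-mp : ∀ {Δ a b} → ⊢[ L ] (a ⇒ b) → Δ ⊢[ L ] a → Δ ⊢[ L ] b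
  ⊢-mp p (inj₁ q)                       = inj₁ (mp p q)
  ⊢-mp p (inj₂ (g , gs , g∈Δ , gs⊆Δ , q)) = inj₂ (g , gs , g∈Δ , gs⊆Δ , ⇒-trans q p)

  Incompatible : Fm → Fm → Set₁
  Incompatible a b = ∀ {Δ} → Consistent L Δ → Δ ⊢[ L ] a → Δ ⊢[ L ] b → ⊥

  incompatible-sym : ∀ {a b} → Incompatible a b → Incompatible b a
  incompatible-sym a#b con ⊢b ⊢a = a#b con ⊢a ⊢b

  incompatible-strengthen : ∀ {a a′ b b′} → ⊢[ L ] (a′ ⇒ a) → ⊢[ L ] (b′ ⇒ b) →
                            Incompatible a b → Incompatible a′ b′
  incompatible-strengthen a′⇒a b′⇒b a#b con ⊢a′ ⊢b′ = a#b con (⊢-mp a′⇒a ⊢a′) (⊢-mp b′⇒b ⊢b′)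

  incompatible-~ : ∀ {a} → Incompatible a (~ a)
  incompatible-~ {a} con ⊢a ⊢~a = con (a , ⊢a , ⊢~a)

  incompatible-□-◇~ : ∀ {a} → Incompatible (□ a) (◇ (~ a))
  incompatible-□-◇~ {a} = incompatible-strengthen (□-mono (~~-intro a)) (⇒-refl _) incompatible-~

  incompatible-◇-□~ : ∀ {a} → Incompatible (◇ a) (□ (~ a))
  incompatible-◇-□~ = incompatible-sym incompatible-~

  incompatible-□⊥-◇ : ∀ {a} → Incompatible (□ ⊥') (◇ a)
  incompatible-□⊥-◇ {a} = incompatible-strengthen (□-mono (ex-falso (~ a))) (⇒-refl _) incompatible-~

  incompatible-if : ∀ {a b} {x y : Bool} → Incompatible a b → x ≢ y →
                    Incompatible (if x then a else b) (if y then a else b)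
  incompatible-if {x = true}  {true}  a#b x≢y = contradiction refl x≢y
  incompatible-if {x = true}  {false} a#b x≢y = a#b
  incompatible-if {x = false} {true}  a#b x≢y = incompatible-sym a#b
  incompatible-if {x = false} {false} a#b x≢y = contradiction refl x≢y

  incompatible-∧ˡ : ∀ {a a′ b b′} → Incompatible a a′ → Incompatible (a ∧' b) (a′ ∧' b′)
  incompatible-∧ˡ = incompatible-strengthen ∧-elimˡ ∧-elimˡ

  incompatible-∧ʳ : ∀ {a a′ b b′} → Incompatible b b′ → Incompatible (a ∧' b) (a′ ∧' b′)
  incompatible-∧ʳ = incompatible-strengthen ∧-elimʳ ∧-elimʳ

necessity actuality possibility : TV → Bool
necessity F  = false
necessity f  = false
necessity f₂ = true
necessity f₃ = true
necessity t₃ = false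
necessity t₂ = true
necessity t  = false
necessity T  = true

actuality F  = false
actuality f  = false
actuality f₂ = false
actuality f₃ = false
actuality t₃ = true
actuality t₂ = true
actuality t  = true
actuality T  = true

possibility F  = false
possibility f  = true
possibility f₂ = false
possibility f₃ = true
possibility t₃ = false
possibility t₂ = false
possibility t  = true
possibility T  = true

fromComponents : Bool → Bool → Bool → TV
fromComponents false false false = F
fromComponents false false true  = f
fromComponents true  false false = f₂
fromComponents true  false true  = f₃
fromComponents false true  false = t₃
fromComponents true  true  false = t₂
fromComponents false true  true  = t
fromComponents true  true  true  = T

fromComponents-components : ∀ v → fromComponents (necessity v) (actuality v) (possibility v) ≡ v
fromComponents-components F  = refl
fromComponents-components f  = refl
fromComponents-components f₂ = refl
fromComponents-components f₃ = refl
fromComponents-components t₃ = refl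
fromComponents-components t₂ = refl
fromComponents-components t  = refl
fromComponents-components T  = refl

components-injective : ∀ {v w} → necessity v ≡ necessity w → actuality v ≡ actuality w →
                       possibility v ≡ possibility w → v ≡ w
components-injective {v} {w} e₁ e₂ e₃ = begin
  v                                                          ≡⟨ fromComponents-components v ⟨
  fromComponents (necessity v) (actuality v) (possibility v) ≡⟨ cong₂ (uncurry ∘ fromComponents) e₁ (cong₂ _,_ e₂ e₃) ⟩
  fromComponents (necessity w) (actuality w) (possibility w) ≡⟨ fromComponents-components w ⟩
  w                                                          ∎
  where open ≡-Reasoning

distinct-values-differ-in-a-component : ∀ {v w} → v ≢ w →
  necessity v ≢ necessity w ⊎ actuality v ≢ actuality w ⊎ possibility v ≢ possibility w
distinct-values-differ-in-a-component {v} {w} v≢w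
  with necessity v ≟ necessity w | actuality v ≟ actuality w | possibility v ≟ possibility w
... | no n₁  | _      | _      = inj₁ n₁
... | yes _  | no n₂  | _      = inj₂ (inj₁ n₂)
... | yes _  | yes _  | no n₃  = inj₂ (inj₂ n₃)
... | yes e₁ | yes e₂ | yes e₃ = contradiction (components-injective e₁ e₂ e₃) v≢w

characterization : Bool → Bool → Bool → Fm → Fm
characterization x y z a =
  (if x then □ a else ◇ (~ a)) ∧' (if y then a else ~ a) ∧' (if z then ◇ a else □ (~ a))

⟦⟧-characterization : ∀ v a → ⟦ v ⟧ a ≡ characterization (necessity v) (actuality v) (possibility v) a
⟦⟧-characterization F  a = refl
⟦⟧-characterization f  a = refl
⟦⟧-characterization f₂ a = refl
⟦⟧-characterization f₃ a = refl
⟦⟧-characterization t₃ a = refl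
⟦⟧-characterization t₂ a = refl
⟦⟧-characterization t  a = refl
⟦⟧-characterization T  a = refl

module _ {L : Logic} where

  characterization-incompatible : ∀ {x y z x′ y′ z′} → x ≢ x′ ⊎ y ≢ y′ ⊎ z ≢ z′ →
    ∀ a → Incompatible {L} (characterization x y z a) (characterization x′ y′ z′ a)
  characterization-incompatible (inj₁ x≢x′) a =
    incompatible-∧ˡ (incompatible-if incompatible-□-◇~ x≢x′)
  characterization-incompatible (inj₂ (inj₁ y≢y′)) a =
    incompatible-∧ʳ (incompatible-∧ˡ (incompatible-if incompatible-~ y≢y′))
  characterization-incompatible (inj₂ (inj₂ z≢z′)) a =
    incompatible-∧ʳ (incompatible-∧ʳ (incompatible-if incompatible-◇-□~ z≢z′))

  distinct-values-incompatible : ∀ {v w} → v ≢ w → ∀ a → Incompatible {L} (⟦ v ⟧ a) (⟦ w ⟧ a)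
  distinct-values-incompatible {v} {w} v≢w a =
    subst₂ Incompatible (sym (⟦⟧-characterization v a)) (sym (⟦⟧-characterization w a))
      (characterization-incompatible (distinct-values-differ-in-a-component v≢w) a)

  degenerate⇒□⊥ : ∀ {v} → Degenerate v → ∀ a → ⊢[ L ] (⟦ v ⟧ a ⇒ □ ⊥')
  degenerate⇒□⊥ (inj₁ refl) a = □-and-□~⇒□⊥
  degenerate⇒□⊥ (inj₂ refl) a = □-and-□~⇒□⊥

  degenerate-or-⇒◇ : ∀ v a → Degenerate v ⊎ Σ Fm (λ b → ⊢[ L ] (⟦ v ⟧ a ⇒ ◇ b))
  degenerate-or-⇒◇ F  a = inj₂ (~ a , ∧-elimˡ)
  degenerate-or-⇒◇ f  a = inj₂ (~ a , ∧-elimˡ)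
  degenerate-or-⇒◇ f₂ a = inj₁ (inj₂ refl)
  degenerate-or-⇒◇ f₃ a = inj₂ (a , ⇒-trans ∧-elimʳ ∧-elimʳ)
  degenerate-or-⇒◇ t₃ a = inj₂ (~ a , ∧-elimˡ)
  degenerate-or-⇒◇ t₂ a = inj₁ (inj₁ refl)
  degenerate-or-⇒◇ t  a = inj₂ (~ a , ∧-elimˡ)
  degenerate-or-⇒◇ T  a = inj₂ (a , ⇒-trans ∧-elimʳ ∧-elimʳ)

  degenerate-only-with-degenerate : ∀ {Δ v w a b} → Consistent L Δ → Degenerate v →
    Δ ⊢[ L ] ⟦ v ⟧ a → Δ ⊢[ L ] ⟦ w ⟧ b → Degenerate w
  degenerate-only-with-degenerate {w = w} {a} {b} con dv ⊢v ⊢w with degenerate-or-⇒◇ w b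
  ... | inj₁ dw          = dw
  ... | inj₂ (c , w⇒◇c) =
    ⊥-elim (incompatible-strengthen (degenerate⇒□⊥ dv a) w⇒◇c incompatible-□⊥-◇ con ⊢v ⊢w)

lemma1 : (L : Logic) (ι κ : TV) → ι ≢ κ → (α β : Fm) (Δ : FmSet) →
    Consistent L Δ →
    ((Δ ⊢[ L ] ⟦ ι ⟧ α) → ¬ (Δ ⊢[ L ] ⟦ κ ⟧ α)) ×
    (Degenerate ι → (Δ ⊢[ L ] ⟦ ι ⟧ α) → (Δ ⊢[ L ] ⟦ κ ⟧ β) → Degenerate κ)
lemma1 L ι κ ι≢κ α β Δ con =
  distinct-values-incompatible ι≢κ α con , degenerate-only-with-degenerate con
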